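{- There do not exist seven mutually skew lines $L_1,\dots,L_7$ in $\mathbb{R}^4$ together with pairwise distinct affine hyperplanes $H_1,\dots,H_7$ of $\mathbb{R}^4$, each containing the origin, such that $H_1\supset L_1\cup L_2\cup L_3$, $H_2\supset L_1\cup L_4\cup L_5$, $H_3\supset L_1\cup L_6\cup L_7$, $H_4\supset L_2\cup L_4\cup L_6$, $H_5\supset L_2\cup L_5\cup L_7$, $H_6\supset L_3\cup L_4\cup L_7$, $H_7\supset L_3\cup L_5\cup L_6$. That is, a $(1,3)$-representation of the Fano plane in $\mathbb{R}^4$ in which the affine hulls of any two of the lines are all linear subspaces (containing the origin) does not exist.
   Context: Two lines in $\mathbb{R}^4$ are skew if they are neither intersecting nor parallel, equivalently their affine hull is three dimensional; mutually skew means pairwise skew. A $(1,3)$-representation of the Fano plane $\mathbb{P}^2(\mathbb{F}_2)$ in $\mathbb{R}^4$ represents its seven points by seven mutually skew lines and its seven lines by seven distinct hyperplanes (three dimensional affine subspaces), with incidence given by containment, as in the list of triples above; in particular, each hyperplane $H_t$ is the affine hull of any two of the three lines it contains. -}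

module Defs where

open import Level using (0ℓ)
open import Data.Fin using (Fin; zero; suc)
open import Data.Product using (Σ; ∃; _×_; _,_)
open import Data.Sum using (_⊎_)
open import Relation.Nullary using (¬_)
open import Relation.Binary using (IsTotalOrder)
open import Algebra.Structures using (IsCommutativeRing)

-- The real numbers, given axiomatically as a complete ordered field
-- (the standard axioms; any two models are isomorphic).  The theorem
-- below is quantified over every such model.

record RealField : Set₁ where
  infixl 7 _*_
  infixl 6 _+_
  infix  4 _≈_ _≤_
  field
    ℝ     : Set
    _≈_   : ℝ → ℝ → Set
    _+_   : ℝ → ℝ → ℝ
    _*_   : ℝ → ℝ → ℝ
    -_    : ℝ → ℝ
    0#    : ℝ
    1#    : ℝ
    _≤_   : ℝ → ℝ → Set
    isCommutativeRing : IsCommutativeRing _≈_ _+_ _*_ -_ 0# 1#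
    0≉1   : ¬ (0# ≈ 1#)
    inverse : ∀ x → ¬ (x ≈ 0#) → ∃ λ y → x * y ≈ 1#
    isTotalOrder : IsTotalOrder _≈_ _≤_
    +-mono-≤ : ∀ {x y} z → x ≤ y → x + z ≤ y + z
    *-nonneg : ∀ {x y} → 0# ≤ x → 0# ≤ y → 0# ≤ x * y
    sup : (P : ℝ → Set) → ∃ P → (∃ λ b → ∀ x → P x → x ≤ b) →
          ∃ λ s → (∀ x → P x → x ≤ s) × (∀ b → (∀ x → P x → x ≤ b) → s ≤ b)

#1 #2 #3 #4 #5 #6 #7 : Fin 7
#1 = zero
#2 = suc zero
#3 = suc (suc zero)
#4 = suc (suc (suc zero))
#5 = suc (suc (suc (suc zero)))
#6 = suc (suc (suc (suc (suc zero))))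
#7 = suc (suc (suc (suc (suc (suc zero)))))

module Geometry (R : RealField) where
  open RealField R

  V : Set
  V = Fin 4 → ℝ

  _≈ᵥ_ : V → V → Set
  u ≈ᵥ v = ∀ i → u i ≈ v i

  _+ᵥ_ : V → V → V
  (u +ᵥ v) i = u i + v i

  _·ᵥ_ : ℝ → V → V
  (t ·ᵥ v) i = t * v i

  𝟎 : V
  𝟎 _ = 0#

  dot : V → V → ℝ
  dot u v = u zero * v zero + u (suc zero) * v (suc zero)
          + u (suc (suc zero)) * v (suc (suc zero))
          + u (suc (suc (suc zero))) * v (suc (suc (suc zero)))

  record Line : Set where
    constructor line
    field
      base : V
      dir  : V
      dir≢0 : ¬ (dir ≈ᵥ 𝟎)

  _∈L_ : V → Line → Set
  x ∈L line p d _ = ∃ λ t → x ≈ᵥ (p +ᵥ (t ·ᵥ d))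

  record Hyperplane₀ : Set where
    constructor hyperplane
    field
      normal : V
      normal≢0 : ¬ (normal ≈ᵥ 𝟎)

  _∈H_ : V → Hyperplane₀ → Set
  x ∈H hyperplane n _ = dot n x ≈ 0#

  _⊆LH_ : Line → Hyperplane₀ → Set
  L ⊆LH H = ∀ x → x ∈L L → x ∈H H

  SameHyperplane : Hyperplane₀ → Hyperplane₀ → Set
  SameHyperplane H K = ∀ x → (x ∈H H → x ∈H K) × (x ∈H K → x ∈H H)

  Intersecting : Line → Line → Set
  Intersecting L M = ∃ λ x → x ∈L L × x ∈L M

  Parallel : Line → Line → Set
  Parallel L M = ∃ λ c → Line.dir L ≈ᵥ (c ·ᵥ Line.dir M)

  Skew : Line → Line → Set
  Skew L M = ¬ Intersecting L M × ¬ Parallel L M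

  FanoIncidences : (Fin 7 → Line) → (Fin 7 → Hyperplane₀) → Set
  FanoIncidences L H =
      (L #1 ⊆LH H #1 × L #2 ⊆LH H #1 × L #3 ⊆LH H #1)
    × (L #1 ⊆LH H #2 × L #4 ⊆LH H #2 × L #5 ⊆LH H #2)
    × (L #1 ⊆LH H #3 × L #6 ⊆LH H #3 × L #7 ⊆LH H #3)
    × (L #2 ⊆LH H #4 × L #4 ⊆LH H #4 × L #6 ⊆LH H #4)
    × (L #2 ⊆LH H #5 × L #5 ⊆LH H #5 × L #7 ⊆LH H #5)
    × (L #3 ⊆LH H #6 × L #4 ⊆LH H #6 × L #7 ⊆LH H #6)
    × (L #3 ⊆LH H #7 × L #5 ⊆LH H #7 × L #6 ⊆LH H #7)

{-# OPTIONS --safe #-}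

-- A line missing the origin spans, together with the origin, a 2-plane; the normals of the
-- three hyperplanes through it are orthogonal to that plane and hence linearly dependent.
-- Skew lines are disjoint, so at most one line meets the origin, and two skew lines cannot
-- both lie in two distinct hyperplanes: their directions and the difference of their base
-- points would be dependent, and the lines would meet.  If all seven Fano triples of
-- normals are dependent, then either N₁, N₂, N₄ are dependent, which puts L₁ and L₂ into
-- both H₁ and H₂, or the normals realise the Fano plane in a 3-space, which forces 2 = 0.
-- If the line through the origin has independent normals A, B, C, a fourth normal D either
-- lies in their span, which puts that line into a fourth hyperplane shared with another
-- line, or completes a basis, and then the remaining Fano relations force a normal to vanish.

module Submission where

open import Defs
open import Level using (0ℓ)
open import Algebra.Bundles using (CommutativeRing)
open import Algebra.Bundles.Raw using (RawRing)
open import Algebra.Solver.Ring.AlmostCommutativeRing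
  using (fromCommutativeRing; _-Raw-AlmostCommutative⟶_)
open import Data.Empty using (⊥; ⊥-elim)
open import Data.Fin.Base using (Fin; zero; suc; _↑ˡ_; _↑ʳ_)
open import Data.Fin.Patterns using (0F; 1F; 2F; 3F; 4F; 5F; 6F)
open import Data.Fin.Properties using (sequence; ¬∀⟶∃¬)
open import Data.Integer.Base as ℤ using (ℤ; +_; -[1+_]; _⊖_; ∣_∣; sign; _◃_)
import Data.Integer.Properties as ℤ
open import Data.Maybe.Base as Maybe using ()
open import Data.Nat.Base as ℕ using (ℕ; zero; suc)
import Data.Nat.Properties as ℕ
open import Data.Product.Base using (∃; ∃₂; _×_; _,_; proj₁; proj₂)
open import Data.Sign.Base as Sign using (Sign)
open import Data.Sum.Base using (inj₁; inj₂)
open import Data.Vec.Base using (Vec; []; _∷_; _++_; tabulate)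
open import Effect.Monad using (RawMonad)
open import Function.Base using (id)
open import Relation.Binary.PropositionalEquality.Core as ≡ using (_≡_; _≢_; ≢-sym)
open import Relation.Binary.Structures using (IsTotalOrder)
open import Relation.Nullary.Decidable.Core using (yes; no; dec⇒maybe; ¬¬-excluded-middle)
open import Relation.Nullary.Negation using (¬_; ¬¬-Monad)

-- The ring solver needs a coefficient ring with decidable equality; ℤ maps into every ring.
module IntegerCoefficients {c ℓ} (R : CommutativeRing c ℓ) where

  open CommutativeRing R
  open import Algebra.Properties.Ring ring using (-1*x≈-x)
  open import Algebra.Properties.AbelianGroup +-abelianGroup using (⁻¹-∙-comm)
  open import Algebra.Properties.Group +-group using (ε⁻¹≈ε; ⁻¹-involutive)
  -- The optimised multiples satisfy 1 ×′ x = x definitionally, so ⟦ + 1 ⟧ℤ is 1#.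
  open import Algebra.Properties.Semiring.Mult.TCOptimised semiring
    using (×-homo-+; ×1-homo-*; 1+×) renaming (_×_ to _×′_)
  open import Relation.Binary.Reasoning.Setoid setoid

  ⟦_⟧ℤ : ℤ → Carrier
  ⟦ + n ⟧ℤ = n ×′ 1#
  ⟦ -[1+ n ] ⟧ℤ = - (suc n ×′ 1#)

  ⟦_⟧ₛ : Sign → Carrier
  ⟦ Sign.+ ⟧ₛ = 1#
  ⟦ Sign.- ⟧ₛ = - 1#

  ⊖-homo : ∀ m n → ⟦ m ⊖ n ⟧ℤ ≈ m ×′ 1# + - (n ×′ 1#)
  ⊖-homo m zero = sym (trans (+-congˡ ε⁻¹≈ε) (+-identityʳ _))
  ⊖-homo zero (suc n) = sym (+-identityˡ _)
  ⊖-homo (suc m) (suc n) = begin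
    ⟦ suc m ⊖ suc n ⟧ℤ                 ≡⟨ ≡.cong ⟦_⟧ℤ (ℤ.[1+m]⊖[1+n]≡m⊖n m n) ⟩
    ⟦ m ⊖ n ⟧ℤ                         ≈⟨ ⊖-homo m n ⟩
    m ×′ 1# + - (n ×′ 1#)                 ≈⟨ +-congʳ (+-identityˡ _) ⟨
    (0# + m ×′ 1#) + - (n ×′ 1#)          ≈⟨ +-congʳ (+-congʳ (-‿inverseʳ 1#)) ⟨
    ((1# + - 1#) + m ×′ 1#) + - (n ×′ 1#) ≈⟨ swap-middle 1# (- 1#) (m ×′ 1#) (- (n ×′ 1#)) ⟩
    (1# + m ×′ 1#) + (- 1# + - (n ×′ 1#)) ≈⟨ +-cong (1+× m 1#) (sym (⁻¹-∙-comm 1# (n ×′ 1#))) ⟨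
    suc m ×′ 1# + - (1# + n ×′ 1#)        ≈⟨ +-congˡ (-‿cong (1+× n 1#)) ⟨
    suc m ×′ 1# + - (suc n ×′ 1#)         ∎
    where
    swap-middle : ∀ a b x y → (a + b) + x + y ≈ (a + x) + (b + y)
    swap-middle a b x y = begin
      (a + b) + x + y   ≈⟨ +-congʳ (+-assoc a b x) ⟩
      a + (b + x) + y   ≈⟨ +-congʳ (+-congˡ (+-comm b x)) ⟩
      a + (x + b) + y   ≈⟨ +-congʳ (+-assoc a x b) ⟨
      (a + x) + b + y   ≈⟨ +-assoc (a + x) b y ⟩
      (a + x) + (b + y) ∎

  +-homo : ∀ i j → ⟦ i ℤ.+ j ⟧ℤ ≈ ⟦ i ⟧ℤ + ⟦ j ⟧ℤ
  +-homo (+ m) (+ n) = ×-homo-+ 1# m n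
  +-homo (+ m) -[1+ n ] = ⊖-homo m (suc n)
  +-homo -[1+ m ] (+ n) = trans (⊖-homo n (suc m)) (+-comm _ _)
  +-homo -[1+ m ] -[1+ n ] = begin
    - (suc (suc (m ℕ.+ n)) ×′ 1#)    ≡⟨ ≡.cong (λ k → - (suc k ×′ 1#)) (ℕ.+-suc m n) ⟨
    - ((suc m ℕ.+ suc n) ×′ 1#)      ≈⟨ -‿cong (×-homo-+ 1# (suc m) (suc n)) ⟩
    - (suc m ×′ 1# + suc n ×′ 1#)     ≈⟨ ⁻¹-∙-comm _ _ ⟨
    - (suc m ×′ 1#) + - (suc n ×′ 1#) ∎

  ◃-homo : ∀ s n → ⟦ s ◃ n ⟧ℤ ≈ ⟦ s ⟧ₛ * (n ×′ 1#)
  ◃-homo s zero = sym (zeroʳ _)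
  ◃-homo Sign.+ (suc n) = sym (*-identityˡ _)
  ◃-homo Sign.- (suc n) = sym (-1*x≈-x _)

  sign-abs-homo : ∀ i → ⟦ i ⟧ℤ ≈ ⟦ sign i ⟧ₛ * (∣ i ∣ ×′ 1#)
  sign-abs-homo (+ n) = sym (*-identityˡ _)
  sign-abs-homo -[1+ n ] = sym (-1*x≈-x _)

  sign-homo : ∀ s t → ⟦ s Sign.* t ⟧ₛ ≈ ⟦ s ⟧ₛ * ⟦ t ⟧ₛ
  sign-homo Sign.+ t = sym (*-identityˡ _)
  sign-homo Sign.- Sign.+ = sym (*-identityʳ _)
  sign-homo Sign.- Sign.- = begin
    1#          ≈⟨ ⁻¹-involutive 1# ⟨
    - (- 1#)    ≈⟨ -1*x≈-x (- 1#) ⟨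
    - 1# * - 1# ∎

  *-homo : ∀ i j → ⟦ i ℤ.* j ⟧ℤ ≈ ⟦ i ⟧ℤ * ⟦ j ⟧ℤ
  *-homo i j = begin
    ⟦ sign i Sign.* sign j ◃ ∣ i ∣ ℕ.* ∣ j ∣ ⟧ℤ
      ≈⟨ ◃-homo (sign i Sign.* sign j) (∣ i ∣ ℕ.* ∣ j ∣) ⟩
    ⟦ sign i Sign.* sign j ⟧ₛ * ((∣ i ∣ ℕ.* ∣ j ∣) ×′ 1#)
      ≈⟨ *-cong (sign-homo (sign i) (sign j)) (×1-homo-* ∣ i ∣ ∣ j ∣) ⟩
    (⟦ sign i ⟧ₛ * ⟦ sign j ⟧ₛ) * ((∣ i ∣ ×′ 1#) * (∣ j ∣ ×′ 1#))
      ≈⟨ interchange _ _ _ _ ⟩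
    (⟦ sign i ⟧ₛ * (∣ i ∣ ×′ 1#)) * (⟦ sign j ⟧ₛ * (∣ j ∣ ×′ 1#))
      ≈⟨ *-cong (sign-abs-homo i) (sign-abs-homo j) ⟨
    ⟦ i ⟧ℤ * ⟦ j ⟧ℤ ∎
    where
    interchange : ∀ a b x y → (a * b) * (x * y) ≈ (a * x) * (b * y)
    interchange a b x y = begin
      (a * b) * (x * y) ≈⟨ *-assoc a b (x * y) ⟩
      a * (b * (x * y)) ≈⟨ *-congˡ (*-assoc b x y) ⟨
      a * ((b * x) * y) ≈⟨ *-congˡ (*-congʳ (*-comm b x)) ⟩
      a * ((x * b) * y) ≈⟨ *-congˡ (*-assoc x b y) ⟩
      a * (x * (b * y)) ≈⟨ *-assoc a x (b * y) ⟨
      (a * x) * (b * y) ∎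

  neg-homo : ∀ i → ⟦ ℤ.- i ⟧ℤ ≈ - ⟦ i ⟧ℤ
  neg-homo (+ zero) = sym ε⁻¹≈ε
  neg-homo (+ suc n) = refl
  neg-homo -[1+ n ] = sym (⁻¹-involutive _)

  ℤ⟶R : ℤ.+-*-rawRing -Raw-AlmostCommutative⟶ fromCommutativeRing R
  ℤ⟶R = record
    { ⟦_⟧ = ⟦_⟧ℤ ; +-homo = +-homo ; *-homo = *-homo ; -‿homo = neg-homo
    ; 0-homo = refl ; 1-homo = refl }

  open import Algebra.Solver.Ring ℤ.+-*-rawRing (fromCommutativeRing R) ℤ⟶R
    (λ i j → Maybe.map (λ i≡j → reflexive (≡.cong ⟦_⟧ℤ i≡j)) (dec⇒maybe (i ℤ.≟ j)))
    public


module Coordinates {c ℓ} (R : RawRing c ℓ) where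

  open RawRing R

  infix  4 _≈ᵥ_
  infixl 6 _-_ _+ᵥ_ _-ᵥ_
  infixr 7 _·ᵥ_

  _-_ : Carrier → Carrier → Carrier
  x - y = x + - y

  Vector : Set c
  Vector = Fin 4 → Carrier

  _≈ᵥ_ : Vector → Vector → Set ℓ
  u ≈ᵥ v = ∀ i → u i ≈ v i

  𝟎 : Vector
  𝟎 _ = 0#

  _+ᵥ_ _-ᵥ_ : Vector → Vector → Vector
  (u +ᵥ v) i = u i + v i
  (u -ᵥ v) i = u i - v i

  _·ᵥ_ : Carrier → Vector → Vector
  (t ·ᵥ v) i = t * v i

  dot : Vector → Vector → Carrier
  dot u v = u 0F * v 0F + u 1F * v 1F + u 2F * v 2F + u 3F * v 3F

  basis : ∀ {n} → Fin n → Fin n → Carrier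
  basis zero zero = 1#
  basis zero (suc _) = 0#
  basis (suc _) zero = 0#
  basis (suc i) (suc j) = basis i j

  det₃ : Vector → Vector → Vector → Fin 4 → Fin 4 → Fin 4 → Carrier
  det₃ a b c i j k = a i * (b j * c k - b k * c j) - a j * (b i * c k - b k * c i)
                   + a k * (b i * c j - b j * c i)

  cross : Vector → Vector → Vector → Vector
  cross a b c 0F = - det₃ a b c 1F 2F 3F
  cross a b c 1F = det₃ a b c 0F 2F 3F
  cross a b c 2F = - det₃ a b c 0F 1F 3F
  cross a b c 3F = det₃ a b c 0F 1F 2F

  det : Vector → Vector → Vector → Vector → Carrier
  det a b c d = dot (cross a b c) d

module DeterminantIdentities {c ℓ} (R : CommutativeRing c ℓ) where

  open CommutativeRing R using (Carrier; _≈_; _+_; _*_; -_; 0#; rawRing; refl)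
  open IntegerCoefficients R using (Polynomial; var; con; _:+_; _:*_; :-_; _:-_; prove; ⟦_⟧; ⟦_⟧↓)
  open Coordinates rawRing public

  -- An identity is stated for the ring and written once more, with the same generic
  -- definitions, for polynomials in the coordinates; evaluating the latter gives the former
  -- definitionally, so the solver's normal-form check proves it.  Vector identities are
  -- checked one coordinate at a time, as cross only computes at concrete indices.
  polynomials : ℕ → RawRing 0ℓ 0ℓ
  polynomials n = record { Carrier = Polynomial n ; _≈_ = _≡_ ; _+_ = _:+_ ; _*_ = _:*_
                         ; -_ = :-_ ; 0# = con (+ 0) ; 1# = con (+ 1) }

  module ᴾ {n} = Coordinates (polynomials n)
  open ᴾ using ()
    renaming (Vector to Vectorᴾ; dot to dotᴾ; basis to basisᴾ; cross to crossᴾ; det to detᴾ;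
              _+ᵥ_ to infixl 6 _+ᴾ_; _·ᵥ_ to infixr 7 _·ᴾ_)

  coordinates : ∀ {m} → Vec Vector m → Vec Carrier (m ℕ.* 4)
  coordinates [] = []
  coordinates (v ∷ vs) = v 0F ∷ v 1F ∷ v 2F ∷ v 3F ∷ coordinates vs

  coordinate : ∀ {m} → Fin m → Fin 4 → Fin (m ℕ.* 4)
  coordinate {suc m} zero k = k ↑ˡ m ℕ.* 4
  coordinate (suc i) k = 4 ↑ʳ coordinate i k

  Poly : ℕ → ℕ → Set
  Poly s m = Polynomial (s ℕ.+ m ℕ.* 4)

  PolyVector : ℕ → ℕ → Set
  PolyVector s m = Vectorᴾ {s ℕ.+ m ℕ.* 4}

  scalarVariables : ∀ s m → Vec (Poly s m) s
  scalarVariables s m = tabulate (λ i → var (i ↑ˡ m ℕ.* 4))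

  vectorVariables : ∀ s m → Vec (PolyVector s m) m
  vectorVariables s m = tabulate (λ i k → var (s ↑ʳ coordinate i k))

  environment : ∀ {s m} → Vec Carrier s → Vec Vector m → Vec Carrier (s ℕ.+ m ℕ.* 4)
  environment xs vs = xs ++ coordinates vs

  byRing : ∀ s m (f : Vec (Poly s m) s → Vec (PolyVector s m) m → Poly s m × Poly s m)
           (xs : Vec Carrier s) (vs : Vec Vector m) →
           let p , q = f (scalarVariables s m) (vectorVariables s m) ; ρ = environment xs vs in
           ⟦ p ⟧↓ ρ ≈ ⟦ q ⟧↓ ρ → ⟦ p ⟧ ρ ≈ ⟦ q ⟧ ρ
  byRing s m f xs vs = prove (environment xs vs) (proj₁ pq) (proj₂ pq)
    where pq = f (scalarVariables s m) (vectorVariables s m)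

  byRing₄ : ∀ s m (f : Vec (Poly s m) s → Vec (PolyVector s m) m → PolyVector s m × PolyVector s m)
            (xs : Vec Carrier s) (vs : Vec Vector m) →
            let p , q = f (scalarVariables s m) (vectorVariables s m) ; ρ = environment xs vs in
            ⟦ p 0F ⟧↓ ρ ≈ ⟦ q 0F ⟧↓ ρ → ⟦ p 1F ⟧↓ ρ ≈ ⟦ q 1F ⟧↓ ρ →
            ⟦ p 2F ⟧↓ ρ ≈ ⟦ q 2F ⟧↓ ρ → ⟦ p 3F ⟧↓ ρ ≈ ⟦ q 3F ⟧↓ ρ →
            (⟦ p 0F ⟧ ρ ≈ ⟦ q 0F ⟧ ρ) × (⟦ p 1F ⟧ ρ ≈ ⟦ q 1F ⟧ ρ) ×
            (⟦ p 2F ⟧ ρ ≈ ⟦ q 2F ⟧ ρ) × (⟦ p 3F ⟧ ρ ≈ ⟦ q 3F ⟧ ρ)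
  byRing₄ s m f xs vs h₀ h₁ h₂ h₃ =
    prove ρ (p 0F) (q 0F) h₀ , prove ρ (p 1F) (q 1F) h₁ , prove ρ (p 2F) (q 2F) h₂ , prove ρ (p 3F) (q 3F) h₃
    where
    ρ = environment xs vs
    p = proj₁ (f (scalarVariables s m) (vectorVariables s m))
    q = proj₂ (f (scalarVariables s m) (vectorVariables s m))

  componentwise : {P : Fin 4 → Set ℓ} → P 0F × P 1F × P 2F × P 3F → ∀ k → P k
  componentwise (p , _ , _ , _) 0F = p
  componentwise (_ , p , _ , _) 1F = p
  componentwise (_ , _ , p , _) 2F = p
  componentwise (_ , _ , _ , p) 3F = p

  cramer : ∀ a b c d w →
    det a b c d ·ᵥ w ≈ᵥ det w b c d ·ᵥ a +ᵥ det a w c d ·ᵥ b +ᵥ det a b w d ·ᵥ c +ᵥ det a b c w ·ᵥ d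
  cramer a b c d w = componentwise (byRing₄ 0 5
    (λ { [] (a ∷ b ∷ c ∷ d ∷ w ∷ []) →
         detᴾ a b c d ·ᴾ w ,
         detᴾ w b c d ·ᴾ a +ᴾ detᴾ a w c d ·ᴾ b +ᴾ detᴾ a b w d ·ᴾ c +ᴾ detᴾ a b c w ·ᴾ d })
    [] (a ∷ b ∷ c ∷ d ∷ w ∷ []) refl refl refl refl)

  det-swap₃₄ : ∀ a b c d → det a b d c + det a b c d ≈ 0#
  det-swap₃₄ a b c d = byRing 0 4
    (λ { [] (a ∷ b ∷ c ∷ d ∷ []) → detᴾ a b d c :+ detᴾ a b c d , con (+ 0) })
    [] (a ∷ b ∷ c ∷ d ∷ []) refl

  cross-swap₁₂ : ∀ a b c → cross b a c +ᵥ cross a b c ≈ᵥ 𝟎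
  cross-swap₁₂ a b c = componentwise (byRing₄ 0 3
    (λ { [] (a ∷ b ∷ c ∷ []) → crossᴾ b a c +ᴾ crossᴾ a b c , λ _ → con (+ 0) })
    [] (a ∷ b ∷ c ∷ []) refl refl refl refl)

  cross-swap₂₃ : ∀ a b c → cross a c b +ᵥ cross a b c ≈ᵥ 𝟎
  cross-swap₂₃ a b c = componentwise (byRing₄ 0 3
    (λ { [] (a ∷ b ∷ c ∷ []) → crossᴾ a c b +ᴾ crossᴾ a b c , λ _ → con (+ 0) })
    [] (a ∷ b ∷ c ∷ []) refl refl refl refl)

  dot-basis : ∀ u k → dot u (basis k) ≈ u k
  dot-basis u = componentwise (byRing₄ 0 1
    (λ { [] (u ∷ []) → (λ k → dotᴾ u (basisᴾ k)) , u })
    [] (u ∷ []) refl refl refl refl)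

  det-basis : ∀ a j → ∃ λ x → ∃₂ λ v w → det a x v w ≈ a j
  det-basis a 0F = basis 1F , basis 2F , basis 3F ,
    byRing 0 1 (λ { [] (a ∷ []) → detᴾ a (basisᴾ 1F) (basisᴾ 2F) (basisᴾ 3F) , a 0F }) [] (a ∷ []) refl
  det-basis a 1F = basis 2F , basis 0F , basis 3F ,
    byRing 0 1 (λ { [] (a ∷ []) → detᴾ a (basisᴾ 2F) (basisᴾ 0F) (basisᴾ 3F) , a 1F }) [] (a ∷ []) refl
  det-basis a 2F = basis 0F , basis 1F , basis 3F ,
    byRing 0 1 (λ { [] (a ∷ []) → detᴾ a (basisᴾ 0F) (basisᴾ 1F) (basisᴾ 3F) , a 2F }) [] (a ∷ []) refl
  det-basis a 3F = basis 1F , basis 0F , basis 2F ,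
    byRing 0 1 (λ { [] (a ∷ []) → detᴾ a (basisᴾ 1F) (basisᴾ 0F) (basisᴾ 2F) , a 3F }) [] (a ∷ []) refl

  det-linear₁ : ∀ x y z w A B C D →
    det (x ·ᵥ A +ᵥ y ·ᵥ B +ᵥ z ·ᵥ C +ᵥ w ·ᵥ D) B C D ≈ x * det A B C D
  det-linear₁ x y z w A B C D = byRing 4 4
    (λ { (x ∷ y ∷ z ∷ w ∷ []) (A ∷ B ∷ C ∷ D ∷ []) →
         detᴾ (x ·ᴾ A +ᴾ y ·ᴾ B +ᴾ z ·ᴾ C +ᴾ w ·ᴾ D) B C D , x :* detᴾ A B C D })
    (x ∷ y ∷ z ∷ w ∷ []) (A ∷ B ∷ C ∷ D ∷ []) refl

  det-linear₂ : ∀ x y z w A B C D →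
    det A (x ·ᵥ A +ᵥ y ·ᵥ B +ᵥ z ·ᵥ C +ᵥ w ·ᵥ D) C D ≈ y * det A B C D
  det-linear₂ x y z w A B C D = byRing 4 4
    (λ { (x ∷ y ∷ z ∷ w ∷ []) (A ∷ B ∷ C ∷ D ∷ []) →
         detᴾ A (x ·ᴾ A +ᴾ y ·ᴾ B +ᴾ z ·ᴾ C +ᴾ w ·ᴾ D) C D , y :* detᴾ A B C D })
    (x ∷ y ∷ z ∷ w ∷ []) (A ∷ B ∷ C ∷ D ∷ []) refl

  det-linear₃ : ∀ x y z w A B C D →
    det A B (x ·ᵥ A +ᵥ y ·ᵥ B +ᵥ z ·ᵥ C +ᵥ w ·ᵥ D) D ≈ z * det A B C D
  det-linear₃ x y z w A B C D = byRing 4 4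
    (λ { (x ∷ y ∷ z ∷ w ∷ []) (A ∷ B ∷ C ∷ D ∷ []) →
         detᴾ A B (x ·ᴾ A +ᴾ y ·ᴾ B +ᴾ z ·ᴾ C +ᴾ w ·ᴾ D) D , z :* detᴾ A B C D })
    (x ∷ y ∷ z ∷ w ∷ []) (A ∷ B ∷ C ∷ D ∷ []) refl

  det-linear₄ : ∀ x y z w A B C D →
    det A B C (x ·ᵥ A +ᵥ y ·ᵥ B +ᵥ z ·ᵥ C +ᵥ w ·ᵥ D) ≈ w * det A B C D
  det-linear₄ x y z w A B C D = byRing 4 4
    (λ { (x ∷ y ∷ z ∷ w ∷ []) (A ∷ B ∷ C ∷ D ∷ []) →
         detᴾ A B C (x ·ᴾ A +ᴾ y ·ᴾ B +ᴾ z ·ᴾ C +ᴾ w ·ᴾ D) , w :* detᴾ A B C D })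
    (x ∷ y ∷ z ∷ w ∷ []) (A ∷ B ∷ C ∷ D ∷ []) refl

  cross-fano : ∀ a b c e f g P Q R →
    cross (a ·ᵥ P +ᵥ b ·ᵥ Q) (c ·ᵥ P +ᵥ e ·ᵥ R) (f ·ᵥ Q +ᵥ g ·ᵥ R) +ᵥ (a * e * f + b * c * g) ·ᵥ cross P Q R ≈ᵥ 𝟎
  cross-fano a b c e f g P Q R = componentwise (byRing₄ 6 3
    (λ { (a ∷ b ∷ c ∷ e ∷ f ∷ g ∷ []) (P ∷ Q ∷ R ∷ []) →
         crossᴾ (a ·ᴾ P +ᴾ b ·ᴾ Q) (c ·ᴾ P +ᴾ e ·ᴾ R) (f ·ᴾ Q +ᴾ g ·ᴾ R)
           +ᴾ (a :* e :* f :+ b :* c :* g) ·ᴾ crossᴾ P Q R ,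
         λ _ → con (+ 0) })
    (a ∷ b ∷ c ∷ e ∷ f ∷ g ∷ []) (P ∷ Q ∷ R ∷ []) refl refl refl refl)

  dot-comm : ∀ u v → dot u v ≈ dot v u
  dot-comm u v = byRing 0 2 (λ { [] (u ∷ v ∷ []) → dotᴾ u v , dotᴾ v u }) [] (u ∷ v ∷ []) refl

  dot-scaleˡ : ∀ c n u → dot (c ·ᵥ n) u ≈ c * dot n u
  dot-scaleˡ c n u = byRing 1 2
    (λ { (c ∷ []) (n ∷ u ∷ []) → dotᴾ (c ·ᴾ n) u , c :* dotᴾ n u }) (c ∷ []) (n ∷ u ∷ []) refl

  dot-scaleʳ : ∀ c n u → dot n (c ·ᵥ u) ≈ c * dot n u
  dot-scaleʳ c n u = byRing 1 2
    (λ { (c ∷ []) (n ∷ u ∷ []) → dotᴾ n (c ·ᴾ u) , c :* dotᴾ n u }) (c ∷ []) (n ∷ u ∷ []) refl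

  dot-sub : ∀ n u v → dot n (u -ᵥ v) ≈ dot n u - dot n v
  dot-sub n u v = byRing 0 3
    (λ { [] (n ∷ u ∷ v ∷ []) → dotᴾ n (u ᴾ.-ᵥ v) , dotᴾ n u :- dotᴾ n v }) [] (n ∷ u ∷ v ∷ []) refl

  dot-linearˡ : ∀ α β a b u → dot (α ·ᵥ a +ᵥ β ·ᵥ b) u ≈ α * dot a u + β * dot b u
  dot-linearˡ α β a b u = byRing 2 3
    (λ { (α ∷ β ∷ []) (a ∷ b ∷ u ∷ []) → dotᴾ (α ·ᴾ a +ᴾ β ·ᴾ b) u , α :* dotᴾ a u :+ β :* dotᴾ b u })
    (α ∷ β ∷ []) (a ∷ b ∷ u ∷ []) refl

  dot-linearʳ : ∀ x y z w n A B C D →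
    dot n (x ·ᵥ A +ᵥ y ·ᵥ B +ᵥ z ·ᵥ C +ᵥ w ·ᵥ D) ≈ x * dot n A + y * dot n B + z * dot n C + w * dot n D
  dot-linearʳ x y z w n A B C D = byRing 4 5
    (λ { (x ∷ y ∷ z ∷ w ∷ []) (n ∷ A ∷ B ∷ C ∷ D ∷ []) →
         dotᴾ n (x ·ᴾ A +ᴾ y ·ᴾ B +ᴾ z ·ᴾ C +ᴾ w ·ᴾ D) ,
         x :* dotᴾ n A :+ y :* dotᴾ n B :+ z :* dotᴾ n C :+ w :* dotᴾ n D })
    (x ∷ y ∷ z ∷ w ∷ []) (n ∷ A ∷ B ∷ C ∷ D ∷ []) refl

  dot-zeroˡ : ∀ u → dot 𝟎 u ≈ 0#
  dot-zeroˡ u = byRing 0 1 (λ { [] (u ∷ []) → dotᴾ (λ _ → con (+ 0)) u , con (+ 0) }) [] (u ∷ []) refl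

-- The t-th hyperplane of the statement contains L (fano₁ t), L (fano₂ t), L (fano₃ t); #1 is 0F.
fano₁ fano₂ fano₃ : Fin 7 → Fin 7
fano₁ 0F = #1
fano₁ 1F = #1
fano₁ 2F = #1
fano₁ 3F = #2
fano₁ 4F = #2
fano₁ 5F = #3
fano₁ 6F = #3
fano₂ 0F = #2
fano₂ 1F = #4
fano₂ 2F = #6
fano₂ 3F = #4
fano₂ 4F = #5
fano₂ 5F = #4
fano₂ 6F = #5
fano₃ 0F = #3
fano₃ 1F = #5
fano₃ 2F = #7
fano₃ 3F = #6
fano₃ 4F = #7
fano₃ 5F = #7
fano₃ 6F = #6


module LinearAlgebra (ℛ : RealField) where

  open RealField ℛ
  open Geometry ℛ
    using (V; Line; line; _∈L_; Intersecting; Parallel; Hyperplane₀; hyperplane; SameHyperplane; _⊆LH_)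

  commutativeRing : CommutativeRing 0ℓ 0ℓ
  commutativeRing = record { isCommutativeRing = isCommutativeRing }

  open CommutativeRing commutativeRing
    using (refl; sym; trans; setoid; *-comm; +-comm; +-cong; +-congˡ; +-congʳ; *-cong; *-congˡ; *-congʳ;
           -‿cong; +-identityˡ; +-identityʳ; *-identityˡ; zeroˡ; zeroʳ; -‿inverseʳ)
  open IntegerCoefficients commutativeRing using (con; _:+_; _:*_; :-_; _:-_; solve; _:=_)
  open DeterminantIdentities commutativeRing public
  open import Relation.Binary.Reasoning.Setoid setoid
  open import Algebra.Properties.Group (CommutativeRing.+-group commutativeRing) using (inverseʳ-unique)
  open RawMonad (¬¬-Monad {0ℓ}) using (_>>=_; pure; rawApplicative)

  ≈ᵥ-refl : ∀ {v} → v ≈ᵥ v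
  ≈ᵥ-refl _ = refl

  infix 4 _≉_
  _≉_ : ℝ → ℝ → Set
  x ≉ y = ¬ x ≈ y

  x≈0⇒x*y≈0 : ∀ {x y} → x ≈ 0# → x * y ≈ 0#
  x≈0⇒x*y≈0 {y = y} x≈0 = trans (*-congʳ x≈0) (zeroˡ y)

  y≈0⇒x*y≈0 : ∀ {x y} → y ≈ 0# → x * y ≈ 0#
  y≈0⇒x*y≈0 {x} y≈0 = trans (*-congˡ y≈0) (zeroʳ x)

  x+y≈0∧y≈0⇒x≈0 : ∀ {x y} → x + y ≈ 0# → y ≈ 0# → x ≈ 0#
  x+y≈0∧y≈0⇒x≈0 {x} x+y≈0 y≈0 = trans (sym (trans (+-congˡ y≈0) (+-identityʳ x))) x+y≈0

  drop-zeros : ∀ {s t u} → t ≈ 0# → u ≈ 0# → s + t + u ≈ s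
  drop-zeros {s} t≈0 u≈0 = trans (+-cong (+-congˡ t≈0) u≈0)
    (solve 1 (λ s → s :+ con (+ 0) :+ con (+ 0) := s) refl s)

  x*x⁻¹≈1∧x*y≈z⇒y≈z*x⁻¹ : ∀ {x x⁻¹ y z} → x * x⁻¹ ≈ 1# → x * y ≈ z → y ≈ z * x⁻¹
  x*x⁻¹≈1∧x*y≈z⇒y≈z*x⁻¹ {x} {x⁻¹} {y} {z} xx⁻¹≈1 xy≈z = begin
    y              ≈⟨ *-identityˡ y ⟨
    1# * y         ≈⟨ *-congʳ xx⁻¹≈1 ⟨
    x * x⁻¹ * y    ≈⟨ solve 3 (λ x x⁻¹ y → x :* x⁻¹ :* y := x :* y :* x⁻¹) refl x x⁻¹ y ⟩
    x * y * x⁻¹    ≈⟨ *-congʳ xy≈z ⟩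
    z * x⁻¹        ∎

  x≉0∧x*y≈0⇒y≈0 : ∀ {x y} → x ≉ 0# → x * y ≈ 0# → y ≈ 0#
  x≉0∧x*y≈0⇒y≈0 {x} x≉0 xy≈0 =
    let _ , xx⁻¹≈1 = inverse x x≉0 in
    trans (x*x⁻¹≈1∧x*y≈z⇒y≈z*x⁻¹ xx⁻¹≈1 xy≈0) (zeroˡ _)

  x*y≉0 : ∀ {x y} → x ≉ 0# → y ≉ 0# → x * y ≉ 0#
  x*y≉0 x≉0 y≉0 xy≈0 = y≉0 (x≉0∧x*y≈0⇒y≈0 x≉0 xy≈0)

  *-cancelʳ-≉0 : ∀ {x y z} → z ≉ 0# → x * z ≈ y * z → x ≈ y
  *-cancelʳ-≉0 {x} {y} {z} z≉0 xz≈yz = begin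
    x                ≈⟨ solve 2 (λ x y → x := x :- y :+ y) refl x y ⟩
    x - y + y        ≈⟨ +-congʳ (x≉0∧x*y≈0⇒y≈0 z≉0 z[x-y]≈0) ⟩
    0# + y           ≈⟨ +-identityˡ y ⟩
    y                ∎
    where
    z[x-y]≈0 : z * (x - y) ≈ 0#
    z[x-y]≈0 = begin
      z * (x - y)    ≈⟨ solve 3 (λ x y z → z :* (x :- y) := x :* z :- y :* z) refl x y z ⟩
      x * z - y * z  ≈⟨ +-congʳ xz≈yz ⟩
      y * z - y * z  ≈⟨ -‿inverseʳ (y * z) ⟩
      0#             ∎

  open IsTotalOrder isTotalOrder using (total; antisym; ≲-respˡ-≈; ≲-respʳ-≈)

  0≤1 : 0# ≤ 1#
  0≤1 with total 0# 1#
  ... | inj₁ 0≤1 = 0≤1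
  ... | inj₂ 1≤0 = ≲-respʳ-≈ [-1][-1]≈1 (*-nonneg 0≤-1 0≤-1)
    where
    0≤-1 : 0# ≤ - 1#
    0≤-1 = ≲-respʳ-≈ (+-identityˡ (- 1#)) (≲-respˡ-≈ (-‿inverseʳ 1#) (+-mono-≤ (- 1#) 1≤0))
    [-1][-1]≈1 : - 1# * - 1# ≈ 1#
    [-1][-1]≈1 = solve 0 (:- con (+ 1) :* :- con (+ 1) := con (+ 1)) refl

  x+x≈0⇒x≈0 : ∀ {x} → x + x ≈ 0# → x ≈ 0#
  x+x≈0⇒x≈0 {x} x+x≈0 = x≉0∧x*y≈0⇒y≈0 1+1≉0
    (trans (solve 1 (λ x → (con (+ 1) :+ con (+ 1)) :* x := x :+ x) refl x) x+x≈0)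
    where
    1+1≉0 : 1# + 1# ≉ 0#
    1+1≉0 1+1≈0 = 0≉1 (antisym 0≤1
      (≲-respʳ-≈ 1+1≈0 (≲-respˡ-≈ (+-identityˡ 1#) (+-mono-≤ 1# 0≤1))))

  Proportional : V → V → Set
  Proportional a b = ∃ λ c → b ≈ᵥ c ·ᵥ a

  Dependent : V → V → V → Set
  Dependent a b c = cross a b c ≈ᵥ 𝟎

  infix 4 _⟂_
  _⟂_ : V → V → Set
  u ⟂ v = dot u v ≈ 0#

  ⟂-sym : ∀ u v → u ⟂ v → v ⟂ u
  ⟂-sym u v u⟂v = trans (dot-comm v u) u⟂v

  dot-congˡ : ∀ {u u'} w → u ≈ᵥ u' → dot u w ≈ dot u' w
  dot-congˡ _ u≈u' = +-cong (+-cong (+-cong (*-congʳ (u≈u' 0F)) (*-congʳ (u≈u' 1F))) (*-congʳ (u≈u' 2F)))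
                          (*-congʳ (u≈u' 3F))

  dot-congʳ : ∀ n {u u'} → u ≈ᵥ u' → dot n u ≈ dot n u'
  dot-congʳ _ u≈u' = +-cong (+-cong (+-cong (*-congˡ (u≈u' 0F)) (*-congˡ (u≈u' 1F))) (*-congˡ (u≈u' 2F)))
                          (*-congˡ (u≈u' 3F))

  cross-cong : ∀ {a a' b b' c c'} → a ≈ᵥ a' → b ≈ᵥ b' → c ≈ᵥ c' → cross a b c ≈ᵥ cross a' b' c'
  cross-cong {a} {a'} {b} {b'} {c} {c'} a≈ b≈ c≈ = λ
    { 0F → -‿cong (det₃-cong 1F 2F 3F) ; 1F → det₃-cong 0F 2F 3F
    ; 2F → -‿cong (det₃-cong 0F 1F 3F) ; 3F → det₃-cong 0F 1F 2F }
    where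
    -cong : ∀ {x x' y y'} → x ≈ x' → y ≈ y' → x - y ≈ x' - y'
    -cong x≈ y≈ = +-cong x≈ (-‿cong y≈)
    minor-cong : ∀ i j → b i * c j - b j * c i ≈ b' i * c' j - b' j * c' i
    minor-cong i j = -cong (*-cong (b≈ i) (c≈ j)) (*-cong (b≈ j) (c≈ i))
    det₃-cong : ∀ i j k → det₃ a b c i j k ≈ det₃ a' b' c' i j k
    det₃-cong i j k = +-cong (-cong (*-cong (a≈ i) (minor-cong j k)) (*-cong (a≈ j) (minor-cong i k)))
                             (*-cong (a≈ k) (minor-cong i j))

  det-cong : ∀ {a a' b b' c c' d d'} → a ≈ᵥ a' → b ≈ᵥ b' → c ≈ᵥ c' → d ≈ᵥ d' → det a b c d ≈ det a' b' c' d'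
  det-cong {a' = a'} {b' = b'} {c' = c'} {d = d} a≈ b≈ c≈ d≈ =
    trans (dot-congˡ d (cross-cong a≈ b≈ c≈)) (dot-congʳ (cross a' b' c') d≈)

  dependent-swap₁₂ : ∀ {a b c} → Dependent a b c → Dependent b a c
  dependent-swap₁₂ {a} {b} {c} dependent k = x+y≈0∧y≈0⇒x≈0 (cross-swap₁₂ a b c k) (dependent k)

  dependent-swap₂₃ : ∀ {a b c} → Dependent a b c → Dependent a c b
  dependent-swap₂₃ {a} {b} {c} dependent k = x+y≈0∧y≈0⇒x≈0 (cross-swap₂₃ a b c k) (dependent k)

  dependent-rotate : ∀ {a b c} → Dependent a b c → Dependent c a b
  dependent-rotate dependent = dependent-swap₁₂ (dependent-swap₂₃ dependent)

  nonzero-if-not-proportional : ∀ {a b} → ¬ Proportional a b → ¬ b ≈ᵥ 𝟎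
  nonzero-if-not-proportional a∤b b≈0 = a∤b (0# , λ k → trans (b≈0 k) (sym (zeroˡ _)))

  some-coordinate-≉0 : ∀ {v} → ¬ v ≈ᵥ 𝟎 → ¬ ¬ ∃ λ j → v j ≉ 0#
  some-coordinate-≉0 {v} v≉0 = do
    v? ← sequence rawApplicative (λ j → ¬¬-excluded-middle {A = v j ≈ 0#})
    pure (¬∀⟶∃¬ 4 (λ j → v j ≈ 0#) v? v≉0)

  proportional-if-combination-vanishes : ∀ {α β a b} → β ≉ 0# → (∀ k → α * a k + β * b k ≈ 0#) →
                                         Proportional a b
  proportional-if-combination-vanishes {α} {β} {a} {b} β≉0 αa+βb≈0 =
    let β⁻¹ , ββ⁻¹≈1 = inverse β β≉0 in
    - α * β⁻¹ , λ k → begin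
      b k                ≈⟨ x*x⁻¹≈1∧x*y≈z⇒y≈z*x⁻¹ ββ⁻¹≈1 (inverseʳ-unique _ _ (αa+βb≈0 k)) ⟩
      - (α * a k) * β⁻¹  ≈⟨ solve 3 (λ α a β⁻¹ → :- (α :* a) :* β⁻¹ := :- α :* β⁻¹ :* a) refl α (a k) β⁻¹ ⟩
      - α * β⁻¹ * a k    ∎

  proportional-if-minors-vanish : ∀ {a b} → ¬ a ≈ᵥ 𝟎 → (∀ x y → a x * b y ≈ a y * b x) →
                                  ¬ ¬ Proportional a b
  proportional-if-minors-vanish {a} {b} a≉0 minors = do
    j , aⱼ≉0 ← some-coordinate-≉0 a≉0
    let aⱼ⁻¹ , aⱼaⱼ⁻¹≈1 = inverse (a j) aⱼ≉0
    pure (b j * aⱼ⁻¹ , λ x → begin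
      b x               ≈⟨ x*x⁻¹≈1∧x*y≈z⇒y≈z*x⁻¹ aⱼaⱼ⁻¹≈1 (minors j x) ⟩
      a x * b j * aⱼ⁻¹  ≈⟨ solve 3 (λ aₓ bⱼ aⱼ⁻¹ → aₓ :* bⱼ :* aⱼ⁻¹ := bⱼ :* aⱼ⁻¹ :* aₓ) refl (a x) (b j) aⱼ⁻¹ ⟩
      b j * aⱼ⁻¹ * a x  ∎)

  proportional-if-common-multiple : ∀ {μ ν a b x} → μ ≉ 0# → a ≈ᵥ μ ·ᵥ x → b ≈ᵥ ν ·ᵥ x → Proportional a b
  proportional-if-common-multiple {μ} {ν} {a} {b} {x} μ≉0 a≈μx b≈νx =
    let μ⁻¹ , μμ⁻¹≈1 = inverse μ μ≉0 in
    ν * μ⁻¹ , λ k → begin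
      b k              ≈⟨ b≈νx k ⟩
      ν * x k          ≈⟨ *-congˡ (x*x⁻¹≈1∧x*y≈z⇒y≈z*x⁻¹ μμ⁻¹≈1 (sym (a≈μx k))) ⟩
      ν * (a k * μ⁻¹)  ≈⟨ solve 3 (λ ν a μ⁻¹ → ν :* (a :* μ⁻¹) := ν :* μ⁻¹ :* a) refl ν (a k) μ⁻¹ ⟩
      ν * μ⁻¹ * a k    ∎

  cramer-⟂ : ∀ n a b c → n ⟂ a → n ⟂ b → n ⟂ c → ∀ v w → det a b c v * dot n w ≈ det a b c w * dot n v
  cramer-⟂ n a b c n⟂a n⟂b n⟂c v w = begin
    det a b c v * dot n w
      ≈⟨ dot-scaleʳ (det a b c v) n w ⟨
    dot n (det a b c v ·ᵥ w)
      ≈⟨ dot-congʳ n (cramer a b c v w) ⟩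
    dot n (det w b c v ·ᵥ a +ᵥ det a w c v ·ᵥ b +ᵥ det a b w v ·ᵥ c +ᵥ det a b c w ·ᵥ v)
      ≈⟨ dot-linearʳ _ _ _ _ n a b c v ⟩
    det w b c v * dot n a + det a w c v * dot n b + det a b w v * dot n c + det a b c w * dot n v
      ≈⟨ +-congʳ (+-cong (+-cong (y≈0⇒x*y≈0 n⟂a) (y≈0⇒x*y≈0 n⟂b)) (y≈0⇒x*y≈0 n⟂c)) ⟩
    0# + 0# + 0# + det a b c w * dot n v
      ≈⟨ solve 1 (λ t → con (+ 0) :+ con (+ 0) :+ con (+ 0) :+ t := t) refl _ ⟩
    det a b c w * dot n v
      ∎

  proportional-to-cross : ∀ n a b c → n ⟂ a → n ⟂ b → n ⟂ c → ¬ Dependent a b c →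
                          ¬ ¬ Proportional (cross a b c) n
  proportional-to-cross n a b c n⟂a n⟂b n⟂c independent =
    proportional-if-minors-vanish independent λ x y → begin
      cross a b c x * n y                    ≈⟨ *-cong (dot-basis (cross a b c) x) (dot-basis n y) ⟨
      det a b c (basis x) * dot n (basis y)  ≈⟨ cramer-⟂ n a b c n⟂a n⟂b n⟂c (basis x) (basis y) ⟩
      det a b c (basis y) * dot n (basis x)  ≈⟨ *-cong (dot-basis (cross a b c) y) (dot-basis n x) ⟩
      cross a b c y * n x                    ∎

  dependent-if-orthogonal : ∀ u v w {n₁ n₂} → n₁ ⟂ u → n₁ ⟂ v → n₁ ⟂ w → n₂ ⟂ u → n₂ ⟂ v → n₂ ⟂ w →
                            ¬ n₂ ≈ᵥ 𝟎 → ¬ Proportional n₂ n₁ → ¬ ¬ Dependent u v w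
  dependent-if-orthogonal u v w {n₁} {n₂} n₁⟂u n₁⟂v n₁⟂w n₂⟂u n₂⟂v n₂⟂w n₂≉0 n₂∤n₁ = do
    no independent ← ¬¬-excluded-middle
      where yes dependent → pure dependent
    μ₁ , n₁≈μ₁X ← proportional-to-cross n₁ u v w n₁⟂u n₁⟂v n₁⟂w independent
    μ₂ , n₂≈μ₂X ← proportional-to-cross n₂ u v w n₂⟂u n₂⟂v n₂⟂w independent
    no μ₂≉0 ← ¬¬-excluded-middle
      where yes μ₂≈0 → ⊥-elim (n₂≉0 λ k → trans (n₂≈μ₂X k) (x≈0⇒x*y≈0 μ₂≈0))
    ⊥-elim (n₂∤n₁ (proportional-if-common-multiple μ₂≉0 n₂≈μ₂X n₁≈μ₁X))

  nonzero-extends-to-basis : ∀ {a} → ¬ a ≈ᵥ 𝟎 → ¬ ¬ ∃ λ x → ∃₂ λ v w → det a x v w ≉ 0#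
  nonzero-extends-to-basis {a} a≉0 = do
    j , aⱼ≉0 ← some-coordinate-≉0 a≉0
    let x , v , w , det≈aⱼ = det-basis a j
    pure (x , v , w , λ det≈0 → aⱼ≉0 (trans (sym det≈aⱼ) det≈0))

  -- If the trial pairs (v, w), (x, w) and (v, x) all fail, Cramer's rule for x exhibits b as a
  -- multiple of a.
  independent-pair-extends-to-basis : ∀ {a b} → ¬ a ≈ᵥ 𝟎 → ¬ Proportional a b →
                                      ¬ ¬ ∃₂ λ v w → det a b v w ≉ 0#
  independent-pair-extends-to-basis {a} {b} a≉0 a∤b = do
    x , v , w , Δ≉0 ← nonzero-extends-to-basis a≉0
    yes abvw≈0 ← ¬¬-excluded-middle
      where no abvw≉0 → pure (v , w , abvw≉0)
    yes abxw≈0 ← ¬¬-excluded-middle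
      where no abxw≉0 → pure (x , w , abxw≉0)
    yes abvx≈0 ← ¬¬-excluded-middle
      where no abvx≉0 → pure (v , x , abvx≉0)
    ⊥-elim (a∤b (proportional-if-combination-vanishes Δ≉0 λ k → begin
      det x b v w * a k + det a x v w * b k
        ≈⟨ drop-zeros (x≈0⇒x*y≈0 abxw≈0) (x≈0⇒x*y≈0 abvx≈0) ⟨
      det x b v w * a k + det a x v w * b k + det a b x w * v k + det a b v x * w k
        ≈⟨ cramer a b v w x k ⟨
      det a b v w * x k
        ≈⟨ x≈0⇒x*y≈0 abvw≈0 ⟩
      0# ∎))

  span-of-dependent : ∀ {a b c} → Dependent a b c → ¬ a ≈ᵥ 𝟎 → ¬ Proportional a b →
                      ¬ ¬ ∃₂ λ α β → c ≈ᵥ α ·ᵥ a +ᵥ β ·ᵥ b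
  span-of-dependent {a} {b} {c} dependent a≉0 a∤b = do
    v , w , Δ≉0 ← independent-pair-extends-to-basis a≉0 a∤b
    let Δ⁻¹ , ΔΔ⁻¹≈1 = inverse (det a b v w) Δ≉0
    pure (det c b v w * Δ⁻¹ , det a c v w * Δ⁻¹ , λ k → begin
      c k
        ≈⟨ x*x⁻¹≈1∧x*y≈z⇒y≈z*x⁻¹ ΔΔ⁻¹≈1 (trans (cramer a b v w c k)
             (drop-zeros (x≈0⇒x*y≈0 (abc-null w)) (x≈0⇒x*y≈0 (abvc≈0 v)))) ⟩
      (det c b v w * a k + det a c v w * b k) * Δ⁻¹
        ≈⟨ solve 5 (λ α a β b Δ⁻¹ → (α :* a :+ β :* b) :* Δ⁻¹ := α :* Δ⁻¹ :* a :+ β :* Δ⁻¹ :* b)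
                 refl (det c b v w) (a k) (det a c v w) (b k) Δ⁻¹ ⟩
      det c b v w * Δ⁻¹ * a k + det a c v w * Δ⁻¹ * b k
        ∎)
    where
    abc-null : ∀ u → det a b c u ≈ 0#
    abc-null u = trans (dot-congˡ u dependent) (dot-zeroˡ u)
    abvc≈0 : ∀ v → det a b v c ≈ 0#
    abvc≈0 v = x+y≈0∧y≈0⇒x≈0 (det-swap₃₄ a b c v) (abc-null v)

  coordinates-unique : ∀ {x y z w x' y' z' w' A B C D} → det A B C D ≉ 0# →
    x ·ᵥ A +ᵥ y ·ᵥ B +ᵥ z ·ᵥ C +ᵥ w ·ᵥ D ≈ᵥ x' ·ᵥ A +ᵥ y' ·ᵥ B +ᵥ z' ·ᵥ C +ᵥ w' ·ᵥ D →
    x ≈ x' × y ≈ y' × z ≈ z' × w ≈ w'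
  coordinates-unique {x} {y} {z} {w} {x'} {y'} {z'} {w'} {A} {B} {C} {D} Δ≉0 u≈u' =
      compare (det-linear₁ x y z w A B C D) (det-linear₁ x' y' z' w' A B C D)
              (det-cong u≈u' (≈ᵥ-refl {B}) (≈ᵥ-refl {C}) (≈ᵥ-refl {D}))
    , compare (det-linear₂ x y z w A B C D) (det-linear₂ x' y' z' w' A B C D)
              (det-cong (≈ᵥ-refl {A}) u≈u' (≈ᵥ-refl {C}) (≈ᵥ-refl {D}))
    , compare (det-linear₃ x y z w A B C D) (det-linear₃ x' y' z' w' A B C D)
              (det-cong (≈ᵥ-refl {A}) (≈ᵥ-refl {B}) u≈u' (≈ᵥ-refl {D}))
    , compare (det-linear₄ x y z w A B C D) (det-linear₄ x' y' z' w' A B C D)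
              (dot-congʳ (cross A B C) u≈u')
    where
    compare : ∀ {p p' d d'} → d ≈ p * det A B C D → d' ≈ p' * det A B C D → d ≈ d' → p ≈ p'
    compare d≈ d'≈ d≈d' = *-cancelʳ-≉0 Δ≉0 (trans (sym d≈) (trans d≈d' d'≈))

  -- Independent A B C extend to a basis by some basis vector eⱼ; compare coordinates there.
  coordinates-unique₃ : ∀ {x y z x' y' z' A B C} → ¬ Dependent A B C →
    x ·ᵥ A +ᵥ y ·ᵥ B +ᵥ z ·ᵥ C ≈ᵥ x' ·ᵥ A +ᵥ y' ·ᵥ B +ᵥ z' ·ᵥ C → ¬ ¬ (x ≈ x' × y ≈ y' × z ≈ z')
  coordinates-unique₃ {A = A} {B} {C} independent u≈u' = do
    j , Xⱼ≉0 ← some-coordinate-≉0 independent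
    let ABCeⱼ≉0 = λ ABCeⱼ≈0 → Xⱼ≉0 (trans (sym (dot-basis (cross A B C) j)) ABCeⱼ≈0)
        x≈x' , y≈y' , z≈z' , _ = coordinates-unique {w = 0#} {w' = 0#} {D = basis j} ABCeⱼ≉0
          λ k → trans drop-zero-term (trans (u≈u' k) (sym drop-zero-term))
    pure (x≈x' , y≈y' , z≈z')
    where
    drop-zero-term : ∀ {s t} → s + 0# * t ≈ s
    drop-zero-term {s} {t} = trans (+-congˡ (zeroˡ t)) (+-identityʳ s)

  proportional-to-first : ∀ {α β a b u} → β ≈ 0# → u ≈ᵥ α ·ᵥ a +ᵥ β ·ᵥ b → Proportional a u
  proportional-to-first {α} β≈0 u≈ =
    α , λ k → trans (u≈ k) (trans (+-congˡ (x≈0⇒x*y≈0 β≈0)) (+-identityʳ _))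

  proportional-to-second : ∀ {α β a b u} → α ≈ 0# → u ≈ᵥ α ·ᵥ a +ᵥ β ·ᵥ b → Proportional b u
  proportional-to-second {β = β} α≈0 u≈ =
    β , λ k → trans (u≈ k) (trans (+-congʳ (x≈0⇒x*y≈0 α≈0)) (+-identityˡ _))

  span-intersection-trivial : ∀ {A B C D F G α β x y u w} → det A B C D ≉ 0# →
    F ≈ᵥ α ·ᵥ B +ᵥ β ·ᵥ D → α ≉ 0# → G ≈ᵥ x ·ᵥ A +ᵥ y ·ᵥ F → G ≈ᵥ u ·ᵥ C +ᵥ w ·ᵥ D → G ≈ᵥ 𝟎
  span-intersection-trivial {A} {B} {C} {D} {F} {G} {α} {β} {x} {y} {u} {w} Δ≉0 F≈ α≉0 G≈xA+yF G≈uC+wD k =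
    begin
      G k                ≈⟨ G≈xA+yF k ⟩
      x * A k + y * F k  ≈⟨ +-cong (x≈0⇒x*y≈0 x≈0) (x≈0⇒x*y≈0 y≈0) ⟩
      0# + 0#            ≈⟨ +-identityˡ 0# ⟩
      0#                 ∎
    where
    in-basis₁ : G ≈ᵥ x ·ᵥ A +ᵥ (y * α) ·ᵥ B +ᵥ 0# ·ᵥ C +ᵥ (y * β) ·ᵥ D
    in-basis₁ k = trans (G≈xA+yF k) (trans (+-congˡ (*-congˡ (F≈ k)))
      (solve 8 (λ x y α β a b c d → x :* a :+ y :* (α :* b :+ β :* d)
                                   := x :* a :+ y :* α :* b :+ con (+ 0) :* c :+ y :* β :* d)
             refl x y α β (A k) (B k) (C k) (D k)))
    in-basis₂ : G ≈ᵥ 0# ·ᵥ A +ᵥ 0# ·ᵥ B +ᵥ u ·ᵥ C +ᵥ w ·ᵥ D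
    in-basis₂ k = trans (G≈uC+wD k)
      (solve 6 (λ u w a b c d → u :* c :+ w :* d := con (+ 0) :* a :+ con (+ 0) :* b :+ u :* c :+ w :* d)
             refl u w (A k) (B k) (C k) (D k))
    coefficients : x ≈ 0# × y * α ≈ 0# × 0# ≈ u × y * β ≈ w
    coefficients = coordinates-unique Δ≉0 λ k → trans (sym (in-basis₁ k)) (in-basis₂ k)
    x≈0 : x ≈ 0#
    x≈0 = proj₁ coefficients
    y≈0 : y ≈ 0#
    y≈0 = x≉0∧x*y≈0⇒y≈0 α≉0 (trans (*-comm α y) (proj₁ (proj₂ coefficients)))

  -- Here u (aef + bcg) = 2 cf yg, which is where characteristic ≠ 2 enters.
  fano-coefficients : ∀ {a b c e f g x y u w} → c ≉ 0# → f ≉ 0# → g ≉ 0# →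
    a * e * f + b * c * g ≈ 0# → x ≈ u * a → y * f ≈ u * b → x ≈ w * c → y * g ≈ w * e → y ≈ 0#
  fano-coefficients {a} {b} {c} {e} {f} {g} {x} {y} {u} {w} c≉0 f≉0 g≉0 s≈0 x≈ua yf≈ub x≈wc yg≈we =
    x≉0∧x*y≈0⇒y≈0 g≉0 (trans (*-comm g y) (x≉0∧x*y≈0⇒y≈0 (x*y≉0 c≉0 f≉0) (x+x≈0⇒x≈0 T+T≈0)))
    where
    T+T≈0 : c * f * (y * g) + c * f * (y * g) ≈ 0#
    T+T≈0 = begin
      c * f * (y * g) + c * f * (y * g)
        ≈⟨ +-congʳ (*-congˡ yg≈we) ⟩
      c * f * (w * e) + c * f * (y * g)
        ≈⟨ solve 6 (λ c e f g w y → c :* f :* (w :* e) :+ c :* f :* (y :* g)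
                                   := w :* c :* e :* f :+ y :* f :* c :* g) refl c e f g w y ⟩
      w * c * e * f + y * f * c * g
        ≈⟨ +-cong (*-congʳ (*-congʳ (trans (sym x≈wc) x≈ua))) (*-congʳ (*-congʳ yf≈ub)) ⟩
      u * a * e * f + u * b * c * g
        ≈⟨ solve 7 (λ u a b c e f g → u :* a :* e :* f :+ u :* b :* c :* g
                                     := u :* (a :* e :* f :+ b :* c :* g)) refl u a b c e f g ⟩
      u * (a * e * f + b * c * g)
        ≈⟨ y≈0⇒x*y≈0 s≈0 ⟩
      0# ∎

  fano-relation : ∀ {a b c e f g P Q R} → ¬ Dependent P Q R →
    Dependent (a ·ᵥ P +ᵥ b ·ᵥ Q) (c ·ᵥ P +ᵥ e ·ᵥ R) (f ·ᵥ Q +ᵥ g ·ᵥ R) → ¬ ¬ (a * e * f + b * c * g ≈ 0#)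
  fano-relation {a} {b} {c} {e} {f} {g} {P} {Q} {R} independent dependent = do
    no s≉0 ← ¬¬-excluded-middle
      where yes s≈0 → pure s≈0
    ⊥-elim (independent λ k → x≉0∧x*y≈0⇒y≈0 s≉0
      (x+y≈0∧y≈0⇒x≈0 (trans (+-comm _ _) (cross-fano a b c e f g P Q R k)) (dependent k)))

  Collinear : (Fin 7 → V) → Fin 7 → Set
  Collinear N ℓ = Dependent (N (fano₁ ℓ)) (N (fano₂ ℓ)) (N (fano₃ ℓ))

  fano-unrealizable : (N : Fin 7 → V) → (∀ i j → i ≢ j → ¬ Proportional (N i) (N j)) →
    (∀ ℓ → Collinear N ℓ) → ¬ Dependent (N #1) (N #2) (N #4) → ¬ ¬ ⊥
  fano-unrealizable N separated collinear independent = do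
    a , b , N₃≈aN₁+bN₂ ← span (collinear #1) (λ ())
    c , e , N₅≈cN₁+eN₄ ← span (collinear #2) (λ ())
    f , g , N₆≈fN₂+gN₄ ← span (collinear #4) (λ ())
    x , y , N₇≈xN₁+yN₆ ← span (collinear #3) (λ ())
    z , w , N₇≈zN₂+wN₅ ← span (collinear #5) (λ ())
    u , v , N₇≈uN₃+vN₄ ← span (collinear #6) (λ ())
    let N₇≈₁ = substitute-second N₇≈xN₁+yN₆ N₆≈fN₂+gN₄
        N₇≈₂ = substitute-second-swapped N₇≈zN₂+wN₅ N₅≈cN₁+eN₄
        N₇≈₃ = substitute-first N₇≈uN₃+vN₄ N₃≈aN₁+bN₂
    x≈ua , yf≈ub , _ ← coordinates-unique₃ independent λ k → trans (sym (N₇≈₁ k)) (N₇≈₃ k)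
    x≈wc , _ , yg≈we ← coordinates-unique₃ independent λ k → trans (sym (N₇≈₁ k)) (N₇≈₂ k)
    s≈0 ← fano-relation independent λ k →
      trans (sym (cross-cong N₃≈aN₁+bN₂ N₅≈cN₁+eN₄ N₆≈fN₂+gN₄ k)) (collinear #7 k)
    let c≉0 = λ c≈0 → separated #4 #5 (λ ()) (proportional-to-second c≈0 N₅≈cN₁+eN₄)
        f≉0 = λ f≈0 → separated #4 #6 (λ ()) (proportional-to-second f≈0 N₆≈fN₂+gN₄)
        g≉0 = λ g≈0 → separated #2 #6 (λ ()) (proportional-to-first g≈0 N₆≈fN₂+gN₄)
        y≈0 = fano-coefficients c≉0 f≉0 g≉0 s≈0 x≈ua yf≈ub x≈wc yg≈we
    ⊥-elim (separated #1 #7 (λ ()) (proportional-to-first y≈0 N₇≈xN₁+yN₆))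
    where
    span : ∀ {p q r} → Dependent (N p) (N q) (N r) → p ≢ q →
           ¬ ¬ ∃₂ λ α β → N r ≈ᵥ α ·ᵥ N p +ᵥ β ·ᵥ N q
    span {p} {q} dependent p≢q = span-of-dependent dependent
      (nonzero-if-not-proportional (separated q p (≢-sym p≢q))) (separated p q p≢q)
    substitute-first : ∀ {t x y f g p q r s} → t ≈ᵥ x ·ᵥ p +ᵥ y ·ᵥ q → p ≈ᵥ f ·ᵥ r +ᵥ g ·ᵥ s →
                       t ≈ᵥ (x * f) ·ᵥ r +ᵥ (x * g) ·ᵥ s +ᵥ y ·ᵥ q
    substitute-first {x = x} {y} {f} {g} {q = q} {r} {s} t≈ p≈ k =
      trans (t≈ k) (trans (+-congʳ (*-congˡ (p≈ k)))
        (solve 7 (λ x y f g q r s → x :* (f :* r :+ g :* s) :+ y :* q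
                                   := x :* f :* r :+ x :* g :* s :+ y :* q)
               refl x y f g (q k) (r k) (s k)))
    substitute-second : ∀ {t x y f g p q r s} → t ≈ᵥ x ·ᵥ p +ᵥ y ·ᵥ q → q ≈ᵥ f ·ᵥ r +ᵥ g ·ᵥ s →
                        t ≈ᵥ x ·ᵥ p +ᵥ (y * f) ·ᵥ r +ᵥ (y * g) ·ᵥ s
    substitute-second {x = x} {y} {f} {g} {p} {r = r} {s} t≈ q≈ k =
      trans (t≈ k) (trans (+-congˡ (*-congˡ (q≈ k)))
        (solve 7 (λ x y f g p r s → x :* p :+ y :* (f :* r :+ g :* s)
                                   := x :* p :+ y :* f :* r :+ y :* g :* s)
               refl x y f g (p k) (r k) (s k)))
    substitute-second-swapped : ∀ {t x y f g p q r s} → t ≈ᵥ x ·ᵥ p +ᵥ y ·ᵥ q →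
                                q ≈ᵥ f ·ᵥ r +ᵥ g ·ᵥ s → t ≈ᵥ (y * f) ·ᵥ r +ᵥ x ·ᵥ p +ᵥ (y * g) ·ᵥ s
    substitute-second-swapped {x = x} {y} {f} {g} {p} {r = r} {s} t≈ q≈ k =
      trans (t≈ k) (trans (+-congˡ (*-congˡ (q≈ k)))
        (solve 7 (λ x y f g p r s → x :* p :+ y :* (f :* r :+ g :* s)
                                   := y :* f :* r :+ x :* p :+ y :* g :* s)
               refl x y f g (p k) (r k) (s k)))

  infix 4 _⟂ᴸ_
  _⟂ᴸ_ : V → Line → Set
  n ⟂ᴸ L = n ⟂ Line.base L × n ⟂ Line.dir L

  ThroughOrigin : Line → Set
  ThroughOrigin L = Proportional (Line.dir L) (Line.base L)

  ⟂-sub : ∀ n u v → n ⟂ u → n ⟂ v → n ⟂ u -ᵥ v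
  ⟂-sub n u v n⟂u n⟂v = trans (dot-sub n u v) (trans (+-cong n⟂u (-‿cong n⟂v)) (-‿inverseʳ 0#))

  ⟂-of-combination : ∀ {α β a b c} x → c ≈ᵥ α ·ᵥ a +ᵥ β ·ᵥ b → β ≉ 0# → a ⟂ x → c ⟂ x → b ⟂ x
  ⟂-of-combination {α} {β} {a} {b} {c} x c≈ β≉0 a⟂x c⟂x = x≉0∧x*y≈0⇒y≈0 β≉0 (x+y≈0∧y≈0⇒x≈0 (begin
    β * dot b x + α * dot a x  ≈⟨ +-comm _ _ ⟩
    α * dot a x + β * dot b x  ≈⟨ dot-linearˡ α β a b x ⟨
    dot (α ·ᵥ a +ᵥ β ·ᵥ b) x   ≈⟨ dot-congˡ x c≈ ⟨
    dot c x                    ≈⟨ c⟂x ⟩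
    0#                         ∎) (y≈0⇒x*y≈0 a⟂x))

  ⟂ᴸ-of-combination : ∀ L {α β a b c} → c ≈ᵥ α ·ᵥ a +ᵥ β ·ᵥ b → β ≉ 0# → a ⟂ᴸ L → c ⟂ᴸ L → b ⟂ᴸ L
  ⟂ᴸ-of-combination L c≈ β≉0 (a⟂p , a⟂d) (c⟂p , c⟂d) =
    ⟂-of-combination (Line.base L) c≈ β≉0 a⟂p c⟂p , ⟂-of-combination (Line.dir L) c≈ β≉0 a⟂d c⟂d

  normal-⟂ᴸ : ∀ L H → L ⊆LH H → Hyperplane₀.normal H ⟂ᴸ L
  normal-⟂ᴸ (line p d _) (hyperplane n _) L⊆H = n⟂p , n⟂d
    where
    n⟂p : n ⟂ p
    n⟂p = L⊆H p (0# , λ k → sym (trans (+-congˡ (zeroˡ (d k))) (+-identityʳ (p k))))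
    n⟂p+d : n ⟂ p +ᵥ d
    n⟂p+d = L⊆H (p +ᵥ d) (1# , λ k → +-congˡ (sym (*-identityˡ (d k))))
    n⟂d : n ⟂ d
    n⟂d = trans (dot-congʳ n λ k → solve 2 (λ p d → d := p :+ d :- p) refl (p k) (d k))
                (⟂-sub n (p +ᵥ d) p n⟂p+d n⟂p)

  origin-∈L : ∀ L → ThroughOrigin L → 𝟎 ∈L L
  origin-∈L (line p d _) (c , p≈cd) = - c , λ k → sym (trans (+-congʳ (p≈cd k))
    (solve 2 (λ c d → c :* d :+ :- c :* d := con (+ 0)) refl c (d k)))

  not-proportional-if-distinct : ∀ H K → ¬ SameHyperplane H K →
                                 ¬ Proportional (Hyperplane₀.normal H) (Hyperplane₀.normal K)
  not-proportional-if-distinct (hyperplane n _) (hyperplane m m≉0) H≠K (c , m≈cn) = ¬¬-excluded-middle λ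
    { (yes c≈0) → m≉0 λ k → trans (m≈cn k) (x≈0⇒x*y≈0 c≈0)
    ; (no c≉0) → H≠K λ x →
        (λ n⟂x → trans (m·x≈c*n·x x) (y≈0⇒x*y≈0 n⟂x)) ,
        (λ m⟂x → x≉0∧x*y≈0⇒y≈0 c≉0 (trans (sym (m·x≈c*n·x x)) m⟂x)) }
    where
    m·x≈c*n·x : ∀ x → dot m x ≈ c * dot n x
    m·x≈c*n·x x = trans (dot-congˡ x m≈cn) (dot-scaleˡ c n x)

  skew-lines-share-one-hyperplane : ∀ L M n₁ n₂ → ¬ Intersecting L M → ¬ Parallel M L →
    n₁ ⟂ᴸ L → n₁ ⟂ᴸ M → n₂ ⟂ᴸ L → n₂ ⟂ᴸ M → ¬ n₂ ≈ᵥ 𝟎 → ¬ Proportional n₂ n₁ → ¬ ¬ ⊥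
  skew-lines-share-one-hyperplane (line p d d≉0) (line q e _) n₁ n₂ L∩M≡∅ M∦L
    (n₁⟂p , n₁⟂d) (n₁⟂q , n₁⟂e) (n₂⟂p , n₂⟂d) (n₂⟂q , n₂⟂e) n₂≉0 n₂∤n₁ = do
    dependent ← dependent-if-orthogonal d e (q -ᵥ p) n₁⟂d n₁⟂e (⟂-sub n₁ q p n₁⟂q n₁⟂p)
                                                   n₂⟂d n₂⟂e (⟂-sub n₂ q p n₂⟂q n₂⟂p) n₂≉0 n₂∤n₁
    α , β , q-p≈αd+βe ← span-of-dependent dependent d≉0 M∦L
    ⊥-elim (L∩M≡∅ (p +ᵥ α ·ᵥ d , (α , λ _ → refl) , (- β , λ k → begin
      p k + α * d k                          ≈⟨ solve 4 (λ p α d βe → p :+ α :* d := p :+ (α :* d :+ βe) :- βe)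
                                                       refl (p k) α (d k) (β * e k) ⟩
      p k + (α * d k + β * e k) - β * e k    ≈⟨ +-congʳ (+-congˡ (q-p≈αd+βe k)) ⟨
      p k + (q k - p k) - β * e k            ≈⟨ solve 4 (λ p q β e → p :+ (q :- p) :- β :* e := q :+ :- β :* e)
                                                       refl (p k) (q k) β (e k) ⟩
      q k + - β * e k                        ∎)))

  dependent-normals-off-origin : ∀ L a b c → ¬ ThroughOrigin L → a ⟂ᴸ L → b ⟂ᴸ L → c ⟂ᴸ L →
                                 ¬ ¬ Dependent a b c
  dependent-normals-off-origin (line p d d≉0) a b c off (a⟂p , a⟂d) (b⟂p , b⟂d) (c⟂p , c⟂d) =
    dependent-if-orthogonal a b c (⟂-sym a p a⟂p) (⟂-sym b p b⟂p) (⟂-sym c p c⟂p)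
                                (⟂-sym a d a⟂d) (⟂-sym b d b⟂d) (⟂-sym c d c⟂d) d≉0 off

  ⟂ᴸ-if-det-vanishes : ∀ L A B C D → ThroughOrigin L → A ⟂ᴸ L × B ⟂ᴸ L × C ⟂ᴸ L → ¬ Dependent A B C →
                       det A B C D ≈ 0# → ¬ ¬ D ⟂ᴸ L
  ⟂ᴸ-if-det-vanishes (line p d _) A B C D (c , p≈cd) ((_ , A⟂d) , (_ , B⟂d) , (_ , C⟂d))
                     independent Δ≈0 = do
    μ , d≈μX ← proportional-to-cross d A B C (⟂-sym A d A⟂d) (⟂-sym B d B⟂d) (⟂-sym C d C⟂d) independent
    let D⟂d = begin
          dot D d                       ≈⟨ dot-congʳ D d≈μX ⟩
          dot D (μ ·ᵥ cross A B C)      ≈⟨ dot-scaleʳ μ D (cross A B C) ⟩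
          μ * dot D (cross A B C)       ≈⟨ *-congˡ (dot-comm D (cross A B C)) ⟩
          μ * det A B C D               ≈⟨ y≈0⇒x*y≈0 Δ≈0 ⟩
          0#                            ∎
    pure (trans (dot-congʳ D p≈cd) (trans (dot-scaleʳ c D d) (y≈0⇒x*y≈0 D⟂d)) , D⟂d)

module FanoConfiguration
  (ℛ : RealField) (L : Fin 7 → Geometry.Line ℛ) (H : Fin 7 → Geometry.Hyperplane₀ ℛ)
  (skew : ∀ i j → i ≢ j → Geometry.Skew ℛ (L i) (L j))
  (distinct : ∀ i j → i ≢ j → ¬ Geometry.SameHyperplane ℛ (H i) (H j))
  (incidences : Geometry.FanoIncidences ℛ L H)
  where

  open Geometry ℛ using (V; Line; Hyperplane₀; FanoIncidences; _⊆LH_)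
  open LinearAlgebra ℛ
  open RawMonad (¬¬-Monad {0ℓ}) using (_>>=_; pure; rawApplicative)

  N : Fin 7 → V
  N t = Hyperplane₀.normal (H t)

  separated : ∀ i j → i ≢ j → ¬ Proportional (N i) (N j)
  separated i j i≢j = not-proportional-if-distinct (H i) (H j) (distinct i j i≢j)

  nonzero : ∀ {i j} → i ≢ j → ¬ N j ≈ᵥ 𝟎
  nonzero i≢j = nonzero-if-not-proportional (separated _ _ i≢j)

  contained : FanoIncidences L H →
              ∀ t → L (fano₁ t) ⊆LH H t × L (fano₂ t) ⊆LH H t × L (fano₃ t) ⊆LH H t
  contained (h , _) 0F = h
  contained (_ , h , _) 1F = h
  contained (_ , _ , h , _) 2F = h
  contained (_ , _ , _ , h , _) 3F = h
  contained (_ , _ , _ , _ , h , _) 4F = h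
  contained (_ , _ , _ , _ , _ , h , _) 5F = h
  contained (_ , _ , _ , _ , _ , _ , h) 6F = h

  normals : ∀ t → N t ⟂ᴸ L (fano₁ t) × N t ⟂ᴸ L (fano₂ t) × N t ⟂ᴸ L (fano₃ t)
  normals t = let L₁⊆Hₜ , L₂⊆Hₜ , L₃⊆Hₜ = contained incidences t in
              normal-⟂ᴸ (L (fano₁ t)) (H t) L₁⊆Hₜ , normal-⟂ᴸ (L (fano₂ t)) (H t) L₂⊆Hₜ ,
              normal-⟂ᴸ (L (fano₃ t)) (H t) L₃⊆Hₜ

  first : ∀ {A B C : Set} → A × B × C → A
  first (a , _ , _) = a

  second : ∀ {A B C : Set} → A × B × C → B
  second (_ , b , _) = b

  third : ∀ {A B C : Set} → A × B × C → C
  third (_ , _ , c) = c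

  -- The labelling is self-dual: Lᵢ lies in H (fano₁ i), H (fano₂ i) and H (fano₃ i).
  containing : ∀ i → N (fano₁ i) ⟂ᴸ L i × N (fano₂ i) ⟂ᴸ L i × N (fano₃ i) ⟂ᴸ L i
  containing 0F = first (normals #1) , first (normals #2) , first (normals #3)
  containing 1F = second (normals #1) , first (normals #4) , first (normals #5)
  containing 2F = third (normals #1) , first (normals #6) , first (normals #7)
  containing 3F = second (normals #2) , second (normals #4) , second (normals #6)
  containing 4F = third (normals #2) , second (normals #5) , second (normals #7)
  containing 5F = second (normals #3) , third (normals #4) , third (normals #7)
  containing 6F = third (normals #3) , third (normals #5) , third (normals #6)

  collinear-off-origin : ∀ i → ¬ ThroughOrigin (L i) → ¬ ¬ Collinear N i
  collinear-off-origin i off = let a⟂Lᵢ , b⟂Lᵢ , c⟂Lᵢ = containing i in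
                               dependent-normals-off-origin (L i) _ _ _ off a⟂Lᵢ b⟂Lᵢ c⟂Lᵢ

  one-line-through-origin : ∀ {i j} → i ≢ j → ThroughOrigin (L i) → ¬ ThroughOrigin (L j)
  one-line-through-origin i≢j Lᵢ∋0 Lⱼ∋0 =
    proj₁ (skew _ _ i≢j) (𝟎 , origin-∈L (L _) Lᵢ∋0 , origin-∈L (L _) Lⱼ∋0)

  -- If N₁, N₂, N₄ are dependent then N₂ is a combination of N₁ and N₄, so L₂ also lies in H₂
  -- and the skew lines L₁, L₂ share H₁ and H₂.
  all-collinear-impossible : (∀ ℓ → Collinear N ℓ) → ¬ ¬ ⊥
  all-collinear-impossible collinear = do
    yes dependent ← ¬¬-excluded-middle
      where no independent → fano-unrealizable N separated collinear independent
    α , β , N₄≈αN₁+βN₂ ← span-of-dependent dependent (nonzero {#2} (λ ())) (separated #1 #2 (λ ()))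
    let β≉0 = λ β≈0 → separated #1 #4 (λ ()) (proportional-to-first β≈0 N₄≈αN₁+βN₂)
        N₂⟂L₂ = ⟂ᴸ-of-combination (L #2) N₄≈αN₁+βN₂ β≉0
                  (first (containing #2)) (second (containing #2))
    skew-lines-share-one-hyperplane (L #1) (L #2) (N #1) (N #2)
      (proj₁ (skew #1 #2 (λ ()))) (proj₂ (skew #2 #1 (λ ())))
      (first (containing #1)) (first (containing #2)) (second (containing #1)) N₂⟂L₂
      (nonzero {#1} (λ ())) (separated #2 #1 (λ ()))

  -- If
  -- det(Nₐ, N_b, N_c, N_d) = 0 then Lₖ also lies in H_d, contradicting skewness; otherwise
  -- N_g lies in span(Nₐ, N_f) ∩ span(N_c, N_d) = 0.
  origin-line-impossible : ∀ {k p a b c d f g} → ThroughOrigin (L k) → ¬ Dependent (N a) (N b) (N c) →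
    N a ⟂ᴸ L k × N b ⟂ᴸ L k × N c ⟂ᴸ L k → N a ⟂ᴸ L p → N d ⟂ᴸ L p → k ≢ p →
    Dependent (N b) (N d) (N f) → Dependent (N a) (N f) (N g) → Dependent (N c) (N d) (N g) →
    b ≢ d → a ≢ f → c ≢ d → d ≢ f → d ≢ g → d ≢ a → ¬ ¬ ⊥
  origin-line-impossible {k} {p} {a} {b} {c} {d} {f} {g} through independent ⟂Lₖ a⟂Lₚ d⟂Lₚ k≢p
                         bdf afg cdg b≢d a≢f c≢d d≢f d≢g d≢a = do
    no Δ≉0 ← ¬¬-excluded-middle
      where yes Δ≈0 → do
              d⟂Lₖ ← ⟂ᴸ-if-det-vanishes (L k) (N a) (N b) (N c) (N d) through ⟂Lₖ independent Δ≈0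
              skew-lines-share-one-hyperplane (L k) (L p) (N a) (N d)
                (proj₁ (skew k p k≢p)) (proj₂ (skew p k (≢-sym k≢p)))
                (first ⟂Lₖ) a⟂Lₚ d⟂Lₖ d⟂Lₚ (nonzero b≢d) (separated d a d≢a)
    α , β , F≈αB+βD ← span-of-dependent bdf (nonzero (≢-sym b≢d)) (separated b d b≢d)
    x , y , G≈xA+yF ← span-of-dependent afg (nonzero (≢-sym a≢f)) (separated a f a≢f)
    u , w , G≈uC+wD ← span-of-dependent cdg (nonzero (≢-sym c≢d)) (separated c d c≢d)
    let α≉0 = λ α≈0 → separated d f d≢f (proportional-to-second α≈0 F≈αB+βD)
    ⊥-elim (nonzero d≢g (span-intersection-trivial Δ≉0 F≈αB+βD α≉0 G≈xA+yF G≈uC+wD))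

  origin-line-impossible-at : ∀ k → ThroughOrigin (L k) → ¬ Collinear N k →
                              (∀ j → j ≢ k → ¬ ¬ Collinear N j) → ¬ ¬ ⊥
  origin-line-impossible-at 0F through independent collinear = do
    ℓ₃ ← collinear #3 (λ ())
    ℓ₄ ← collinear #4 (λ ())
    ℓ₆ ← collinear #6 (λ ())
    origin-line-impossible through independent (containing #1)
      (first (containing #2)) (second (containing #2)) (λ ())
      ℓ₄ ℓ₃ ℓ₆ (λ ()) (λ ()) (λ ()) (λ ()) (λ ()) (λ ())
  origin-line-impossible-at 1F through independent collinear = do
    ℓ₃ ← collinear #3 (λ ())
    ℓ₄ ← collinear #4 (λ ())
    ℓ₅ ← collinear #5 (λ ())
    origin-line-impossible through independent (containing #2)
      (first (containing #1)) (second (containing #1)) (λ ())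
      (dependent-swap₁₂ ℓ₄) ℓ₃ (dependent-swap₁₂ ℓ₅) (λ ()) (λ ()) (λ ()) (λ ()) (λ ()) (λ ())
  origin-line-impossible-at 2F through independent collinear = do
    ℓ₂ ← collinear #2 (λ ())
    ℓ₄ ← collinear #4 (λ ())
    ℓ₅ ← collinear #5 (λ ())
    origin-line-impossible through independent (containing #3)
      (first (containing #1)) (second (containing #1)) (λ ())
      (dependent-rotate ℓ₄) ℓ₂ (dependent-rotate ℓ₅) (λ ()) (λ ()) (λ ()) (λ ()) (λ ()) (λ ())
  origin-line-impossible-at 3F through independent collinear = do
    ℓ₂ ← collinear #2 (λ ())
    ℓ₃ ← collinear #3 (λ ())
    ℓ₅ ← collinear #5 (λ ())
    origin-line-impossible through independent (containing #4)
      (second (containing #1)) (first (containing #1)) (λ ())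
      (dependent-swap₁₂ ℓ₂) ℓ₅ (dependent-swap₁₂ ℓ₃) (λ ()) (λ ()) (λ ()) (λ ()) (λ ()) (λ ())
  origin-line-impossible-at 4F through independent collinear = do
    ℓ₂ ← collinear #2 (λ ())
    ℓ₃ ← collinear #3 (λ ())
    ℓ₄ ← collinear #4 (λ ())
    origin-line-impossible through independent (containing #5)
      (second (containing #1)) (first (containing #1)) (λ ())
      (dependent-rotate ℓ₂) ℓ₄ (dependent-rotate ℓ₃) (λ ()) (λ ()) (λ ()) (λ ()) (λ ()) (λ ())
  origin-line-impossible-at 5F through independent collinear = do
    ℓ₂ ← collinear #2 (λ ())
    ℓ₃ ← collinear #3 (λ ())
    ℓ₇ ← collinear #7 (λ ())
    origin-line-impossible through independent (containing #6)
      (third (containing #1)) (first (containing #1)) (λ ())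
      (dependent-swap₁₂ ℓ₂) ℓ₇ (dependent-rotate ℓ₃) (λ ()) (λ ()) (λ ()) (λ ()) (λ ()) (λ ())
  origin-line-impossible-at 6F through independent collinear = do
    ℓ₂ ← collinear #2 (λ ())
    ℓ₃ ← collinear #3 (λ ())
    ℓ₆ ← collinear #6 (λ ())
    origin-line-impossible through independent (containing #7)
      (third (containing #1)) (first (containing #1)) (λ ())
      (dependent-rotate ℓ₂) ℓ₆ (dependent-swap₁₂ ℓ₃) (λ ()) (λ ()) (λ ()) (λ ()) (λ ()) (λ ())

  every-line-collinear : ¬ (∃ λ k → ThroughOrigin (L k) × ¬ Collinear N k) → ∀ ℓ → ¬ ¬ Collinear N ℓ
  every-line-collinear no-exception ℓ not-collinear = ¬¬-excluded-middle λ
    { (yes through) → no-exception (ℓ , through , not-collinear)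
    ; (no off) → collinear-off-origin ℓ off not-collinear }

  contradiction : ¬ ¬ ⊥
  contradiction = do
    no no-exception ← ¬¬-excluded-middle
      where yes (k , through , independent) →
              origin-line-impossible-at k through independent λ j j≢k →
                collinear-off-origin j (one-line-through-origin (≢-sym j≢k) through)
    collinear ← sequence rawApplicative (every-line-collinear no-exception)
    all-collinear-impossible collinear

mainTheorem3 : (R : RealField) → let open Geometry R in
    ¬ (∃₂ λ (L : Fin 7 → Line) (H : Fin 7 → Hyperplane₀) →
         (∀ i j → i ≢ j → Skew (L i) (L j))
       × (∀ i j → i ≢ j → ¬ SameHyperplane (H i) (H j))
       × FanoIncidences L H)
mainTheorem3 ℛ (L , H , skew , distinct , incidences) =
  FanoConfiguration.contradiction ℛ L H skew distinct incidences id
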